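{- Let $G_1,G_2$ be ordered graphs, and let $L_1,L_2$ be the maximum number of vertices of a monotone path in $G_1,G_2$, respectively. Then the maximum number of vertices of a monotone path in the lexicographic product $G_1\otimes G_2$ is exactly $L_1L_2$.
   Context: An ordered graph is a finite graph with a linear order on its vertex set. A path in an ordered graph is monotone if its vertices, in traversal order, are increasing. The lexicographic product $G_1\otimes G_2$ is the ordered graph with vertex set $V(G_2)\times V(G_1)$, ordered by $(u,x)<(u',x')$ iff $u<u'$ in $G_2$, or $u=u'$ and $x<x'$ in $G_1$; two vertices $(u,x),(u',x')$ are adjacent iff either $u\neq u'$ and $uu'\in E(G_2)$, or $u=u'$ and $xx'\in E(G_1)$. (That is, each vertex of $G_2$ is blown up into an interval carrying a copy of $G_1$, and edges of $G_2$ become complete bipartite graphs.) -}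

module Defs where

open import Data.Nat using (ℕ; _≤_)
open import Data.Fin using (Fin; toℕ; _<_)
open import Data.Product using (_×_; _,_; Σ; ∃-syntax)
open import Data.Sum using (_⊎_)
open import Relation.Binary.PropositionalEquality using (_≡_)
open import Relation.Nullary using (¬_)
import Data.Nat as ℕ

-- A finite ordered (simple) graph: the vertex set is Fin n with its
-- usual linear order, and E is a symmetric irreflexive adjacency relation.
record OrderedGraph : Set₁ where
  field
    n      : ℕ
    E      : Fin n → Fin n → Set
    E-sym  : ∀ {x y} → E x y → E y x
    E-irr  : ∀ {x} → ¬ E x x

-- A monotone path with k vertices in a structure with vertex type V,
-- strict order _<<_ and adjacency _~_: a sequence p : Fin k → V whose
-- consecutive vertices are adjacent and strictly increasing.
-- (Strict increase already makes the vertices distinct.)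
record MonotonePath (V : Set) (_<<_ : V → V → Set) (_~_ : V → V → Set) (k : ℕ) : Set where
  field
    vtx        : Fin k → V
    increasing : ∀ (i : Fin k) (j : Fin k) → i < j → vtx i << vtx j
    adjacent   : ∀ (i : Fin k) (j : Fin k) → toℕ j ≡ ℕ.suc (toℕ i) → vtx i ~ vtx j

IsMaxMonotonePath : (V : Set) (_<<_ : V → V → Set) (_~_ : V → V → Set) → ℕ → Set
IsMaxMonotonePath V _<<_ _~_ L =
  MonotonePath V _<<_ _~_ L × (∀ k → MonotonePath V _<<_ _~_ k → k ≤ L)

MaxMonotonePathLength : OrderedGraph → ℕ → Set
MaxMonotonePathLength G L = IsMaxMonotonePath (Fin n) _<_ E L
  where open OrderedGraph G

LexVertex : OrderedGraph → OrderedGraph → Set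
LexVertex G₁ G₂ = Fin (OrderedGraph.n G₂) × Fin (OrderedGraph.n G₁)

LexLt : (G₁ G₂ : OrderedGraph) → LexVertex G₁ G₂ → LexVertex G₁ G₂ → Set
LexLt G₁ G₂ (u , x) (u′ , x′) = (u < u′) ⊎ ((u ≡ u′) × (x < x′))

LexAdj : (G₁ G₂ : OrderedGraph) → LexVertex G₁ G₂ → LexVertex G₁ G₂ → Set
LexAdj G₁ G₂ (u , x) (u′ , x′) =
  ((¬ u ≡ u′) × OrderedGraph.E G₂ u u′) ⊎ ((u ≡ u′) × OrderedGraph.E G₁ x x′)

MaxMonotonePathLengthLex : (G₁ G₂ : OrderedGraph) → ℕ → Set
MaxMonotonePathLengthLex G₁ G₂ L =
  IsMaxMonotonePath (LexVertex G₁ G₂) (LexLt G₁ G₂) (LexAdj G₁ G₂) L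

{-# OPTIONS --safe #-}
-- A monotone path in G₁ ⊗ G₂ runs through a sequence of blocks whose indices form a monotone
-- path of G₂, and inside each block it is a monotone path of G₁; so it has at most L₁ L₂
-- vertices. Conversely, running through a longest path of G₁ inside each block of a longest
-- path of G₂, in lexicographic order, gives a monotone path with L₁ L₂ vertices.
module Submission where

open import Defs
open import Data.Nat using (ℕ; zero; suc; _+_; _*_; _≤_; z≤n; s≤s; s<s)
open import Data.Nat.Properties
  using (suc-injective; ≤-reflexive; ≤-trans; m≤m+n; +-monoˡ-≤; *-monoʳ-≤; *-suc; *-comm; module ≤-Reasoning)
open import Data.Fin.Base as Fin using (Fin; toℕ)
open import Data.Fin.Properties using (<-trans; <⇒≢)
open import Data.List.Base using (List; []; _∷_; length; lookup; tabulate; map; _++_; last; cartesianProduct)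
open import Data.List.Properties
  using (length-tabulate; length-map; length-++; ++-identityʳ; last-map; cartesianProductWith-zeroʳ)
open import Data.List.Relation.Unary.Linked as Linked using (Linked; []; [-]; _∷_)
open import Data.List.Relation.Unary.Linked.Properties using (map⁺; ++⁺)
open import Data.Maybe.Base as Maybe using (just; nothing)
open import Data.Maybe.Relation.Binary.Connected using (Connected; just; nothing-just)
open import Data.Product using (_×_; _,_; proj₁; proj₂; ∃-syntax; ∃₂)
open import Data.Sum using (_⊎_; inj₁; inj₂)
open import Data.Empty using (⊥-elim)
open import Level using (0ℓ)
open import Relation.Binary.Core using (Rel)
open import Relation.Binary.Definitions using (Transitive)
open import Relation.Binary.Construct.Intersection using (_∩_)
open import Relation.Binary.PropositionalEquality using (_≡_; refl; sym; trans; cong; cong₂; subst; module ≡-Reasoning)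

module _ {A : Set} {R : Rel A 0ℓ} where

  tabulate⁺ : ∀ {k} {f : Fin k → A} →
              (∀ i j → toℕ j ≡ suc (toℕ i) → R (f i) (f j)) → Linked R (tabulate f)
  tabulate⁺ {zero}        _ = []
  tabulate⁺ {suc zero}    _ = [-]
  tabulate⁺ {suc (suc k)} h = h Fin.zero (Fin.suc Fin.zero) refl
                            ∷ tabulate⁺ (λ i j eq → h (Fin.suc i) (Fin.suc j) (cong suc eq))

  lookup-consecutive : ∀ {xs} → Linked R xs → ∀ i j → toℕ j ≡ suc (toℕ i) →
                       R (lookup xs i) (lookup xs j)
  lookup-consecutive (r ∷ _)  Fin.zero    (Fin.suc Fin.zero) _  = r
  lookup-consecutive (_ ∷ rs) (Fin.suc i) (Fin.suc j)        eq =
    lookup-consecutive rs i j (suc-injective eq)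

  lookup-< : Transitive R → ∀ {xs} → Linked R xs → ∀ i j → i Fin.< j →
             R (lookup xs i) (lookup xs j)
  lookup-< R-trans (r ∷ rs) Fin.zero    (Fin.suc j) _         = Linked.lookup R-trans rs (just r) j
  lookup-< R-trans (_ ∷ rs) (Fin.suc i) (Fin.suc j) (s<s i<j) = lookup-< R-trans rs i j i<j

module _ {V : Set} {_<<_ _~_ : Rel V 0ℓ} where

  linked⇒monotonePath : Transitive _<<_ → ∀ {xs} → Linked (_<<_ ∩ _~_) xs →
                        MonotonePath V _<<_ _~_ (length xs)
  linked⇒monotonePath <<-trans {xs} l = record
    { vtx        = lookup xs
    ; increasing = lookup-< <<-trans (proj₁ (Linked.unzip l))
    ; adjacent   = lookup-consecutive (proj₂ (Linked.unzip l))
    }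

  monotonePath⇒linked : ∀ {k} → MonotonePath V _<<_ _~_ k →
                        ∃[ xs ] length xs ≡ k × Linked (_<<_ ∩ _~_) xs
  monotonePath⇒linked p =
    tabulate vtx , length-tabulate vtx ,
    tabulate⁺ (λ i j eq → increasing i j (≤-reflexive (sym eq)) , adjacent i j eq)
    where open MonotonePath p

length-cartesianProduct : ∀ {A B : Set} (xs : List A) (ys : List B) →
                          length (cartesianProduct xs ys) ≡ length xs * length ys
length-cartesianProduct []       ys = refl
length-cartesianProduct (x ∷ xs) ys = begin
  length (map (x ,_) ys ++ cartesianProduct xs ys)
    ≡⟨ length-++ (map (x ,_) ys) ⟩
  length (map (x ,_) ys) + length (cartesianProduct xs ys)
    ≡⟨ cong₂ _+_ (length-map (x ,_) ys) (length-cartesianProduct xs ys) ⟩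
  length ys + length xs * length ys ∎
  where open ≡-Reasoning

MonotoneEdge : (G : OrderedGraph) → Rel (Fin (OrderedGraph.n G)) 0ℓ
MonotoneEdge G = Fin._<_ ∩ OrderedGraph.E G

Path : OrderedGraph → ℕ → Set
Path G = MonotonePath (Fin (OrderedGraph.n G)) Fin._<_ (OrderedGraph.E G)

linked-length-≤ : ∀ {G L} → (∀ k → Path G k → k ≤ L) →
                  ∀ {xs} → Linked (MonotoneEdge G) xs → length xs ≤ L
linked-length-≤ bound l = bound _ (linked⇒monotonePath <-trans l)

module LexProduct (G₁ G₂ : OrderedGraph) where

  LexEdge : Rel (LexVertex G₁ G₂) 0ℓ
  LexEdge = LexLt G₁ G₂ ∩ LexAdj G₁ G₂

  LexPath : ℕ → Set
  LexPath = MonotonePath (LexVertex G₁ G₂) (LexLt G₁ G₂) (LexAdj G₁ G₂)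

  LexLt-trans : Transitive (LexLt G₁ G₂)
  LexLt-trans (inj₁ u<v)          (inj₁ v<w)          = inj₁ (<-trans u<v v<w)
  LexLt-trans (inj₁ u<v)          (inj₂ (refl , _))   = inj₁ u<v
  LexLt-trans (inj₂ (refl , _))   (inj₁ v<w)          = inj₁ v<w
  LexLt-trans (inj₂ (refl , x<y)) (inj₂ (refl , y<z)) = inj₂ (refl , <-trans x<y y<z)

  lexEdge-between : ∀ {u v x y} → MonotoneEdge G₂ u v → LexEdge (u , x) (v , y)
  lexEdge-between (u<v , uv) = inj₁ u<v , inj₁ (<⇒≢ u<v , uv)

  lexEdge-within : ∀ {u x y} → MonotoneEdge G₁ x y → LexEdge (u , x) (u , y)
  lexEdge-within (x<y , xy) = inj₂ (refl , x<y) , inj₂ (refl , xy)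

  lexEdge-cases : ∀ {u v x y} → LexEdge (u , x) (v , y) →
                  MonotoneEdge G₂ u v ⊎ (u ≡ v × MonotoneEdge G₁ x y)
  lexEdge-cases (inj₁ u<v          , inj₁ (_ , uv))   = inj₁ (u<v , uv)
  lexEdge-cases (inj₁ u<v          , inj₂ (u≡v , _))  = ⊥-elim (<⇒≢ u<v u≡v)
  lexEdge-cases (inj₂ (u≡v , _)    , inj₁ (u≢v , _))  = ⊥-elim (u≢v u≡v)
  lexEdge-cases (inj₂ (u≡v , x<y)  , inj₂ (_ , xy))   = inj₂ (u≡v , x<y , xy)

  cartesianProduct⁺ : ∀ {us xs} → Linked (MonotoneEdge G₂) us → Linked (MonotoneEdge G₁) xs →
                      Linked LexEdge (cartesianProduct us xs)
  cartesianProduct⁺ {us} {[]} _ _ = subst (Linked LexEdge) (sym (cartesianProductWith-zeroʳ _,_ us)) []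
  cartesianProduct⁺ []       _  = []
  cartesianProduct⁺ [-]      lx =
    subst (Linked LexEdge) (sym (++-identityʳ _)) (map⁺ (Linked.map lexEdge-within lx))
  cartesianProduct⁺ {u ∷ v ∷ _} {x ∷ xs} (uv ∷ lu) lx =
    ++⁺ (map⁺ (Linked.map lexEdge-within lx)) junction (cartesianProduct⁺ lu lx)
    where
    connected : ∀ m → Connected LexEdge (Maybe.map (u ,_) m) (just (v , x))
    connected (just y) = just (lexEdge-between uv)
    connected nothing  = nothing-just

    junction : Connected LexEdge (last (map (u ,_) (x ∷ xs))) (just (v , x))
    junction = subst (λ m → Connected LexEdge m (just (v , x)))
                     (sym (last-map (u ,_) (x ∷ xs))) (connected (last (x ∷ xs)))

  lexPath : ∀ {K₁ K₂} → Path G₁ K₁ → Path G₂ K₂ → LexPath (K₁ * K₂)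
  lexPath p₁ p₂ with monotonePath⇒linked p₁ | monotonePath⇒linked p₂
  ... | xs , refl , lx | us , refl , lu =
    subst LexPath (trans (length-cartesianProduct us xs) (*-comm (length us) (length xs)))
          (linked⇒monotonePath LexLt-trans (cartesianProduct⁺ lu lx))

  module _ {L₁} (bound₁ : ∀ {xs} → Linked (MonotoneEdge G₁) xs → length xs ≤ L₁) where

    firstBlock-absorb : ∀ {x xs} → Linked (MonotoneEdge G₁) (x ∷ xs) → ∀ m →
                        suc (length xs) + L₁ * m ≤ L₁ * suc m
    firstBlock-absorb lx m = begin
      suc _ + L₁ * m  ≤⟨ +-monoˡ-≤ (L₁ * m) (bound₁ lx) ⟩
      L₁ + L₁ * m     ≡⟨ *-suc L₁ m ⟨
      L₁ * suc m      ∎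
      where open ≤-Reasoning

    -- xs is the part of the walk inside its first block u, and us lists the later blocks,
    -- each of which contributes at most L₁ vertices.
    lexWalk-decompose : ∀ {u x zs} → Linked LexEdge ((u , x) ∷ zs) →
                        ∃₂ λ xs us → Linked (MonotoneEdge G₁) (x ∷ xs) × Linked (MonotoneEdge G₂) (u ∷ us)
                                   × suc (length zs) ≤ suc (length xs) + L₁ * length us
    lexWalk-decompose {zs = []} [-] = [] , [] , [-] , [-] , m≤m+n 1 _
    lexWalk-decompose (e ∷ lz) with lexWalk-decompose lz | lexEdge-cases e
    ... | xs , us , lx , lu , le | inj₁ uv =
      [] , _ ∷ us , [-] , uv ∷ lu , s≤s (≤-trans le (firstBlock-absorb lx (length us)))
    ... | xs , us , lx , lu , le | inj₂ (refl , xy) = _ ∷ xs , us , xy ∷ lx , lu , s≤s le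

    lexWalk-length-≤ : ∀ {L₂} → (∀ {us} → Linked (MonotoneEdge G₂) us → length us ≤ L₂) →
                       ∀ {zs} → Linked LexEdge zs → length zs ≤ L₁ * L₂
    lexWalk-length-≤ _ {[]} _ = z≤n
    lexWalk-length-≤ {L₂} bound₂ {_ ∷ zs} lz with lexWalk-decompose lz
    ... | xs , us , lx , lu , le = begin
      suc (length zs)                   ≤⟨ le ⟩
      suc (length xs) + L₁ * length us  ≤⟨ firstBlock-absorb lx (length us) ⟩
      L₁ * suc (length us)              ≤⟨ *-monoʳ-≤ L₁ (bound₂ lu) ⟩
      L₁ * L₂                           ∎
      where open ≤-Reasoning

  lexPath-length-≤ : ∀ {L₁ L₂} → (∀ k → Path G₁ k → k ≤ L₁) → (∀ k → Path G₂ k → k ≤ L₂) →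
                     ∀ k → LexPath k → k ≤ L₁ * L₂
  lexPath-length-≤ bound₁ bound₂ k p with monotonePath⇒linked p
  ... | zs , refl , lz =
    lexWalk-length-≤ (linked-length-≤ {G₁} bound₁) (linked-length-≤ {G₂} bound₂) lz

proposition3p2 : (G₁ G₂ : OrderedGraph) (L₁ L₂ : ℕ) →
    MaxMonotonePathLength G₁ L₁ → MaxMonotonePathLength G₂ L₂ →
    MaxMonotonePathLengthLex G₁ G₂ (L₁ * L₂)
proposition3p2 G₁ G₂ L₁ L₂ (longest₁ , bound₁) (longest₂ , bound₂) =
  lexPath longest₁ longest₂ , lexPath-length-≤ bound₁ bound₂
  where open LexProduct G₁ G₂
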